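{- For any integer $\ell\geq 1$, \[\sum_{(m_1,\dots,m_t)}(-1)^{t}\cdot \binom{\ell-m_1}{m_1-1}\binom{\ell-m_2}{m_2}\dotsm \binom{\ell-m_t}{m_t}=(-1)^\ell C_{\ell-1},\] where the sum is over all sequences $(m_1,\dots,m_t)$ ($t\geq 1$) of positive integers with $m_1+\dots+m_t=\ell$.
   Context: $C_j=\binom{2j}{j}/(j+1)$ denotes the $j$-th Catalan number. Binomial coefficients follow the convention that for integers $a\geq 0$ and $b$, $\binom{a}{b}=0$ unless $0\leq b\leq a$. -}

module Defs where

open import Data.Nat using (ℕ; zero; suc; _+_; _∸_)
open import Data.Nat.Combinatorics using (_C_)
open import Data.Integer as ℤ using (ℤ; +_; -_)
open import Data.List using (List; []; _∷_; concatMap; map; length)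

-- Compositions: all sequences (m₁,…,m_t) of positive integers with sum n
-- (t ≥ 0; the empty sequence occurs only for n = 0).
-- compositionsAux k n: compositions of n whose first part is ≤ ... enumerated
-- by fuel k ≥ n (fuel only ensures structural termination).
compositionsAux : ℕ → ℕ → List (List ℕ)
compositionsAux _       zero    = [] ∷ []
compositionsAux zero    (suc n) = []
compositionsAux (suc k) (suc n) =
  concatMap (λ m → map (suc m ∷_) (compositionsAux k (n ∸ m))) (Data.List.upTo (suc n))
  where import Data.List

compositions : ℕ → List (List ℕ)
compositions n = compositionsAux n n

catalan : ℕ → ℕ
catalan j = ((2 Data.Nat.* j) C j) Data.Nat./ suc j
  where import Data.Nat

sign : ℕ → ℤ
sign zero    = + 1
sign (suc k) = - sign k

tailProd : ℕ → List ℕ → ℕ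
tailProd ℓ []       = 1
tailProd ℓ (m ∷ ms) = ((ℓ ∸ m) C m) Data.Nat.* tailProd ℓ ms
  where import Data.Nat

-- summand (-1)^t · binom(ℓ-m₁, m₁-1) · ∏_{i≥2} binom(ℓ-m_i, m_i); empty sequence contributes 0
-- (it never occurs for ℓ ≥ 1).
term : ℕ → List ℕ → ℤ
term ℓ []       = + 0
term ℓ (m ∷ ms) = sign (length (m ∷ ms)) ℤ.* (+ (((ℓ ∸ m) C (m ∸ 1)) Data.Nat.* tailProd ℓ ms))
  where import Data.Nat

sumℤ : List ℤ → ℤ
sumℤ []       = + 0
sumℤ (x ∷ xs) = x ℤ.+ sumℤ xs

-- Power series over ℤ are represented by their coefficient functions ℕ → ℤ.
-- Let F_ℓ = Σₙ C(ℓ-n, n) xⁿ. Expanding 1/F_ℓ as a geometric series, its n-th coefficient is the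
-- sum over compositions of n of (-1)^t ∏ C(ℓ-mᵢ, mᵢ); splitting off the first part m₁ turns the
-- sum of the theorem, for ℓ = n+1, into -[xⁿ] F_n / F_{n+1}.
-- Put y = Σₖ (-1)^k C_k x^(k+1), so that Segner's recurrence reads y + y² = x. Together with the
-- Fibonacci recursion F_{ℓ+2} = F_{ℓ+1} + x F_ℓ it gives F_{ℓ+1} y ≡ x F_ℓ mod x^(ℓ+2) by
-- induction on ℓ, hence [x^(n+1)] x F_n / F_{n+1} = [x^(n+1)] y = (-1)^n C_n.
-- Segner's recurrence itself comes from the closed form of C_k through the ratio
-- (k+2) C_{k+1} = 2(2k+1) C_k and the Leibniz rule for θ = x d/dx.
module Submission where

open import Function using (_∘_; id)
open import Data.Nat as ℕ using (ℕ; zero; suc; _∸_; _≤_; _<_; _≥_; z≤n; s≤s)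
import Data.Nat.Properties as ℕₚ
open import Data.Nat.Combinatorics using (_C_)
open import Data.List using (List; []; _∷_; _++_; map; concatMap; applyUpTo; upTo; length)
open import Data.List.Properties using (map-++; map-cong; map-∘; concatMap-cong)
open import Relation.Binary.PropositionalEquality

open import Defs

module BinomialCoefficients where
  open import Data.Nat using (_*_; _+_)
  open import Data.Nat.Properties
  open import Data.Nat.Combinatorics using (nCk+nC[k+1]≡[n+1]C[k+1]; k>n⇒nCk≡0; nCk≡nC[n∸k]; nC1≡n)
  open import Data.Nat.Divisibility using (_∣_; m∣m*n)
  open import Data.Nat.DivMod using (m*[n/m]≡n)
  import Data.Nat.Tactic.RingSolver as ℕSolver

  absorption : ∀ n k → suc k * (suc n C suc k) ≡ suc n * (n C k)
  absorption zero    zero    = refl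
  absorption zero    (suc k)
    rewrite k>n⇒nCk≡0 {1} {suc (suc k)} (s≤s (s≤s z≤n)) | k>n⇒nCk≡0 {0} {suc k} (s≤s z≤n) =
    *-zeroʳ (suc (suc k))
  absorption (suc n) zero    = trans (+-identityʳ _) (trans (nC1≡n (suc (suc n))) (sym (*-identityʳ _)))
  absorption (suc n) (suc k) = begin
    suc (suc k) * (suc (suc n) C suc (suc k))
      ≡⟨ cong (suc (suc k) *_) (nCk+nC[k+1]≡[n+1]C[k+1] (suc n) (suc k)) ⟨
    suc (suc k) * (suc n C suc k + suc n C suc (suc k))
      ≡⟨ *-distribˡ-+ (suc (suc k)) (suc n C suc k) _ ⟩
    suc (suc k) * (suc n C suc k) + suc (suc k) * (suc n C suc (suc k))
      ≡⟨ cong₂ (λ u v → suc n C suc k + u + v) (absorption n k) (absorption n (suc k)) ⟩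
    suc n C suc k + suc n * (n C k) + suc n * (n C suc k)
      ≡⟨ +-assoc (suc n C suc k) _ _ ⟩
    suc n C suc k + (suc n * (n C k) + suc n * (n C suc k))
      ≡⟨ cong (suc n C suc k +_) (*-distribˡ-+ (suc n) (n C k) _) ⟨
    suc n C suc k + suc n * (n C k + n C suc k)
      ≡⟨ cong (λ u → suc n C suc k + suc n * u) (nCk+nC[k+1]≡[n+1]C[k+1] n k) ⟩
    suc (suc n) * (suc n C suc k) ∎
    where open ≡-Reasoning

  pascal-∸ : ∀ a m j → m ≤ j → (suc a ∸ m) C suc j ≡ (a ∸ m) C j + (a ∸ m) C suc j
  pascal-∸ a       zero    j       _     = sym (nCk+nC[k+1]≡[n+1]C[k+1] a j)
  pascal-∸ zero    (suc m) (suc j) _     rewrite 0∸n≡0 m =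
    sym (cong (_+ 0 C suc (suc j)) (k>n⇒nCk≡0 {0} {suc j} (s≤s z≤n)))
  pascal-∸ (suc a) (suc m) j       m<j   = pascal-∸ a m j (<⇒≤ m<j)

  centralBinomial : ℕ → ℕ
  centralBinomial k = (2 * k) C k

  central-symmetry : ∀ k → suc (2 * k) C suc k ≡ suc (2 * k) C k
  central-symmetry k =
    trans (nCk≡nC[n∸k] (s≤s (m≤m+n k (k + 0))))
          (cong (suc (2 * k) C_) (trans (m+n∸m≡n k (k + 0)) (+-identityʳ k)))

  central-ratio : ∀ k → suc k * centralBinomial (suc k) ≡ 2 * (suc (2 * k) * centralBinomial k)
  central-ratio k = begin
    suc k * ((2 * suc k) C suc k)           ≡⟨ cong (λ n → suc k * (n C suc k)) (double-suc k) ⟩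
    suc k * (suc (suc (2 * k)) C suc k)     ≡⟨ absorption (suc (2 * k)) k ⟩
    suc (suc (2 * k)) * (suc (2 * k) C k)   ≡⟨ double-suc-* k (suc (2 * k) C k) ⟩
    2 * (suc k * (suc (2 * k) C k))         ≡⟨ cong (λ c → 2 * (suc k * c)) (central-symmetry k) ⟨
    2 * (suc k * (suc (2 * k) C suc k))     ≡⟨ cong (2 *_) (absorption (2 * k) k) ⟩
    2 * (suc (2 * k) * centralBinomial k)   ∎
    where
    open ≡-Reasoning
    double-suc : ∀ k → 2 * suc k ≡ suc (suc (2 * k))
    double-suc = ℕSolver.solve-∀
    double-suc-* : ∀ k c → suc (suc (2 * k)) * c ≡ 2 * (suc k * c)
    double-suc-* = ℕSolver.solve-∀

  central-neighbour : ∀ k → suc k * ((2 * k) C suc k) ≡ k * centralBinomial k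
  central-neighbour k = +-cancelˡ-≡ (suc k * c) _ _ (begin
    suc k * c + suc k * d          ≡⟨ *-distribˡ-+ (suc k) c d ⟨
    suc k * (c + d)                ≡⟨ cong (suc k *_) (nCk+nC[k+1]≡[n+1]C[k+1] (2 * k) k) ⟩
    suc k * (suc (2 * k) C suc k)  ≡⟨ absorption (2 * k) k ⟩
    suc (2 * k) * c                ≡⟨ split k c ⟩
    suc k * c + k * c              ∎)
    where
    open ≡-Reasoning
    c = centralBinomial k
    d = (2 * k) C suc k
    split : ∀ k c → suc (2 * k) * c ≡ suc k * c + k * c
    split = ℕSolver.solve-∀

  suc∣centralBinomial : ∀ k → suc k ∣ centralBinomial k
  suc∣centralBinomial k = subst (suc k ∣_) quotient-eq (m∣m*n (c ∸ d))
    where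
    open ≡-Reasoning
    c = centralBinomial k
    d = (2 * k) C suc k
    quotient-eq : suc k * (c ∸ d) ≡ c
    quotient-eq = begin
      suc k * (c ∸ d)            ≡⟨ *-distribˡ-∸ (suc k) c d ⟩
      suc k * c ∸ suc k * d      ≡⟨ cong (suc k * c ∸_) (central-neighbour k) ⟩
      c + k * c ∸ k * c          ≡⟨ m+n∸n≡m c (k * c) ⟩
      c                          ∎

  suc*catalan : ∀ k → suc k * catalan k ≡ centralBinomial k
  suc*catalan k = m*[n/m]≡n (suc∣centralBinomial k)

  catalan-ratio : ∀ k → suc (suc k) * catalan (suc k) ≡ 2 * (suc (2 * k) * catalan k)
  catalan-ratio k = *-cancelˡ-≡ _ _ (suc k) (begin
    suc k * (suc (suc k) * catalan (suc k))  ≡⟨ cong (suc k *_) (suc*catalan (suc k)) ⟩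
    suc k * centralBinomial (suc k)          ≡⟨ central-ratio k ⟩
    2 * (suc (2 * k) * centralBinomial k)    ≡⟨ cong (λ c → 2 * (suc (2 * k) * c)) (suc*catalan k) ⟨
    2 * (suc (2 * k) * (suc k * catalan k))  ≡⟨ reorder k (catalan k) ⟩
    suc k * (2 * (suc (2 * k) * catalan k))  ∎)
    where
    open ≡-Reasoning
    reorder : ∀ k c → 2 * (suc (2 * k) * (suc k * c)) ≡ suc k * (2 * (suc (2 * k) * c))
    reorder = ℕSolver.solve-∀

open BinomialCoefficients using (pascal-∸; catalan-ratio)

open import Data.Integer using (ℤ; +_; -_; _+_; _*_; -1ℤ)
open import Data.Integer.Properties
open import Data.Integer.Tactic.RingSolver using (solve-∀)

infixl 6 _⊕_
infixl 7 _∗_ _·_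
infix 4 _≗[<_]_

_⊕_ : (ℕ → ℤ) → (ℕ → ℤ) → ℕ → ℤ
(f ⊕ g) n = f n + g n

_·_ : ℤ → (ℕ → ℤ) → ℕ → ℤ
(c · f) n = c * f n

_∗_ : (ℕ → ℤ) → (ℕ → ℤ) → ℕ → ℤ
(f ∗ g) zero    = f 0 * g 0
(f ∗ g) (suc n) = f 0 * g (suc n) + ((f ∘ suc) ∗ g) n

one : ℕ → ℤ
one zero    = + 1
one (suc _) = + 0

shift : (ℕ → ℤ) → ℕ → ℤ
shift f zero    = + 0
shift f (suc n) = f n

X : ℕ → ℤ
X = shift one

twist : (ℕ → ℤ) → ℕ → ℤ
twist f n = sign n * f n

θ : (ℕ → ℤ) → ℕ → ℤ
θ f n = + n * f n

_≗[<_]_ : (ℕ → ℤ) → ℕ → (ℕ → ℤ) → Set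
f ≗[< N ] g = ∀ i → i < N → f i ≡ g i

∗-congˡ-< : ∀ {f f' N} g → f ≗[< N ] f' → f ∗ g ≗[< N ] f' ∗ g
∗-congˡ-< g eq zero    0<N       = cong (_* g 0) (eq 0 0<N)
∗-congˡ-< g eq (suc i) (s≤s i<N) =
  cong₂ _+_ (cong (_* g (suc i)) (eq 0 (s≤s z≤n)))
            (∗-congˡ-< g (λ j j<N → eq (suc j) (s≤s j<N)) i i<N)

∗-congˡ : ∀ {f f'} g → f ≗ f' → f ∗ g ≗ f' ∗ g
∗-congˡ g eq n = ∗-congˡ-< g (λ i _ → eq i) n (ℕₚ.n<1+n n)

∗-congʳ : ∀ f {g g'} → g ≗ g' → f ∗ g ≗ f ∗ g'
∗-congʳ f eq zero    = cong (f 0 *_) (eq 0)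
∗-congʳ f eq (suc n) = cong₂ _+_ (cong (f 0 *_) (eq (suc n))) (∗-congʳ (f ∘ suc) eq n)

∗-unfoldʳ : ∀ f g n → (f ∗ g) (suc n) ≡ (f ∗ (g ∘ suc)) n + f (suc n) * g 0
∗-unfoldʳ f g zero    = refl
∗-unfoldʳ f g (suc n) =
  trans (cong (_+_ (f 0 * g (suc (suc n)))) (∗-unfoldʳ (f ∘ suc) g n))
        (sym (+-assoc (f 0 * g (suc (suc n))) _ (f (suc (suc n)) * g 0)))

∗-comm : ∀ f g → f ∗ g ≗ g ∗ f
∗-comm f g zero    = *-comm (f 0) (g 0)
∗-comm f g (suc n) = begin
  f 0 * g (suc n) + ((f ∘ suc) ∗ g) n  ≡⟨ cong₂ _+_ (*-comm (f 0) _) (∗-comm (f ∘ suc) g n) ⟩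
  g (suc n) * f 0 + (g ∗ (f ∘ suc)) n  ≡⟨ +-comm (g (suc n) * f 0) _ ⟩
  (g ∗ (f ∘ suc)) n + g (suc n) * f 0  ≡⟨ ∗-unfoldʳ g f n ⟨
  (g ∗ f) (suc n)                      ∎
  where open ≡-Reasoning

∗-distribʳ-⊕ : ∀ f g h → (f ⊕ g) ∗ h ≗ f ∗ h ⊕ g ∗ h
∗-distribʳ-⊕ f g h zero    = *-distribʳ-+ (h 0) (f 0) (g 0)
∗-distribʳ-⊕ f g h (suc n) =
  trans (cong (_+_ ((f 0 + g 0) * h (suc n))) (∗-distribʳ-⊕ (f ∘ suc) (g ∘ suc) h n))
        (distrib-interchange (f 0) (g 0) (h (suc n)) _ _)
  where
  distrib-interchange : ∀ a b x u v → (a + b) * x + (u + v) ≡ (a * x + u) + (b * x + v)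
  distrib-interchange = solve-∀

∗-distribˡ-⊕ : ∀ f g h → f ∗ (g ⊕ h) ≗ f ∗ g ⊕ f ∗ h
∗-distribˡ-⊕ f g h n = begin
  (f ∗ (g ⊕ h)) n          ≡⟨ ∗-comm f (g ⊕ h) n ⟩
  ((g ⊕ h) ∗ f) n          ≡⟨ ∗-distribʳ-⊕ g h f n ⟩
  (g ∗ f) n + (h ∗ f) n    ≡⟨ cong₂ _+_ (∗-comm g f n) (∗-comm h f n) ⟩
  (f ∗ g) n + (f ∗ h) n    ∎
  where open ≡-Reasoning

·-∗ : ∀ c f g → c · f ∗ g ≗ c · (f ∗ g)
·-∗ c f g zero    = *-assoc c (f 0) (g 0)
·-∗ c f g (suc n) =
  trans (cong (_+_ (c * f 0 * g (suc n))) (·-∗ c (f ∘ suc) g n))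
        (factor c (f 0) (g (suc n)) _)
  where
  factor : ∀ c a x u → c * a * x + c * u ≡ c * (a * x + u)
  factor = solve-∀

∗-assoc : ∀ f g h → (f ∗ g) ∗ h ≗ f ∗ (g ∗ h)
∗-assoc f g h zero    = *-assoc (f 0) (g 0) (h 0)
∗-assoc f g h (suc n) = begin
  -- (f ∗ g) ∘ suc unfolds to f 0 · (g ∘ suc) ⊕ (f ∘ suc) ∗ g
  f 0 * g 0 * h (suc n) + ((f 0 · (g ∘ suc) ⊕ (f ∘ suc) ∗ g) ∗ h) n
    ≡⟨ cong (_+_ (f 0 * g 0 * h (suc n))) (∗-distribʳ-⊕ _ _ h n) ⟩
  f 0 * g 0 * h (suc n) + ((f 0 · (g ∘ suc) ∗ h) n + (((f ∘ suc) ∗ g) ∗ h) n)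
    ≡⟨ cong (_+_ (f 0 * g 0 * h (suc n))) (cong₂ _+_ (·-∗ (f 0) (g ∘ suc) h n) (∗-assoc (f ∘ suc) g h n)) ⟩
  f 0 * g 0 * h (suc n) + (f 0 * ((g ∘ suc) ∗ h) n + ((f ∘ suc) ∗ (g ∗ h)) n)
    ≡⟨ factor (f 0) (g 0) (h (suc n)) _ _ ⟩
  (f ∗ (g ∗ h)) (suc n) ∎
  where
  open ≡-Reasoning
  factor : ∀ a b x u v → a * b * x + (a * u + v) ≡ a * (b * x + u) + v
  factor = solve-∀

∗-identityʳ : ∀ f → f ∗ one ≗ f
∗-identityʳ f zero    = *-identityʳ (f 0)
∗-identityʳ f (suc n) =
  trans (cong₂ _+_ (*-zeroʳ (f 0)) (∗-identityʳ (f ∘ suc) n)) (+-identityˡ (f (suc n)))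

shift-∗ : ∀ f g → shift f ∗ g ≗ shift (f ∗ g)
shift-∗ f g zero    = refl
shift-∗ f g (suc n) = +-identityˡ ((f ∗ g) n)

∗-shift : ∀ f g → f ∗ shift g ≗ shift (f ∗ g)
∗-shift f g zero    = *-zeroʳ (f 0)
∗-shift f g (suc n) = trans (∗-comm f (shift g) (suc n)) (trans (shift-∗ g f (suc n)) (∗-comm g f n))

∗-X : ∀ f → f ∗ X ≗ shift f
∗-X f zero    = *-zeroʳ (f 0)
∗-X f (suc n) = trans (∗-shift f one (suc n)) (∗-identityʳ f n)

shift-cong-< : ∀ {f g N} → f ≗[< N ] g → shift f ≗[< suc N ] shift g
shift-cong-< eq zero    _         = refl
shift-cong-< eq (suc i) (s≤s i<N) = eq i i<N

∗-shift-congˡ-< : ∀ {f f' N} h → f ≗[< N ] f' → f ∗ shift h ≗[< suc N ] f' ∗ shift h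
∗-shift-congˡ-< {f} {f'} h eq i i<1+N = begin
  (f ∗ shift h) i   ≡⟨ ∗-shift f h i ⟩
  shift (f ∗ h) i   ≡⟨ shift-cong-< (∗-congˡ-< h eq) i i<1+N ⟩
  shift (f' ∗ h) i  ≡⟨ ∗-shift f' h i ⟨
  (f' ∗ shift h) i  ∎
  where open ≡-Reasoning

twist-∗ : ∀ f g → twist f ∗ twist g ≗ twist (f ∗ g)
twist-∗ f g zero    = unit (f 0) (g 0)
  where
  unit : ∀ a b → + 1 * a * (+ 1 * b) ≡ + 1 * (a * b)
  unit = solve-∀
twist-∗ f g (suc n) = begin
  + 1 * f 0 * twist g (suc n) + ((twist f ∘ suc) ∗ twist g) n
    ≡⟨ cong (_+_ (+ 1 * f 0 * twist g (suc n))) (∗-congˡ (twist g) twist-suc n) ⟩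
  + 1 * f 0 * twist g (suc n) + (-1ℤ · twist (f ∘ suc) ∗ twist g) n
    ≡⟨ cong (_+_ (+ 1 * f 0 * twist g (suc n))) (·-∗ -1ℤ (twist (f ∘ suc)) (twist g) n) ⟩
  + 1 * f 0 * twist g (suc n) + -1ℤ * (twist (f ∘ suc) ∗ twist g) n
    ≡⟨ cong (λ u → + 1 * f 0 * twist g (suc n) + -1ℤ * u) (twist-∗ (f ∘ suc) g n) ⟩
  + 1 * f 0 * (- sign n * g (suc n)) + -1ℤ * (sign n * ((f ∘ suc) ∗ g) n)
    ≡⟨ factor (sign n) (f 0) (g (suc n)) _ ⟩
  twist (f ∗ g) (suc n) ∎
  where
  open ≡-Reasoning
  twist-suc : twist f ∘ suc ≗ -1ℤ · twist (f ∘ suc)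
  twist-suc k = trans (sym (neg-distribˡ-* (sign k) _)) (sym (-1*i≡-i _))
  factor : ∀ s a x u → + 1 * a * (- s * x) + -1ℤ * (s * u) ≡ - s * (a * x + u)
  factor = solve-∀

θ-∗ : ∀ f g → θ (f ∗ g) ≗ θ f ∗ g ⊕ f ∗ θ g
θ-∗ f g zero    = sym (trans (+-identityˡ _) (*-zeroʳ (f 0)))
θ-∗ f g (suc n) = begin
  + suc n * (f 0 * g (suc n) + B)
    ≡⟨ expand (+ n) (f 0) (g (suc n)) B ⟩
  + n * B + B + f 0 * (+ suc n * g (suc n))
    ≡⟨ cong (λ u → u + B + f 0 * (+ suc n * g (suc n))) (θ-∗ (f ∘ suc) g n) ⟩
  A + C + B + f 0 * (+ suc n * g (suc n))
    ≡⟨ regroup (f 0) (g (suc n)) (+ n) A B C ⟩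
  (+ 0 * f 0 * g (suc n) + (A + B)) + (f 0 * (+ suc n * g (suc n)) + C)
    ≡⟨ cong (λ u → (+ 0 * f 0 * g (suc n) + u) + (f 0 * (+ suc n * g (suc n)) + C)) θ-tail ⟨
  (θ f ∗ g ⊕ f ∗ θ g) (suc n) ∎
  where
  open ≡-Reasoning
  A = (θ (f ∘ suc) ∗ g) n
  B = ((f ∘ suc) ∗ g) n
  C = ((f ∘ suc) ∗ θ g) n
  θ-suc : θ f ∘ suc ≗ θ (f ∘ suc) ⊕ f ∘ suc
  θ-suc k = trans (suc-* (+ k) (f (suc k))) (+-comm (f (suc k)) _)
  θ-tail : ((θ f ∘ suc) ∗ g) n ≡ A + B
  θ-tail = trans (∗-congˡ g θ-suc n) (∗-distribʳ-⊕ _ _ g n)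
  expand : ∀ m a x b → (+ 1 + m) * (a * x + b) ≡ m * b + b + a * ((+ 1 + m) * x)
  expand = solve-∀
  regroup : ∀ a x m u v w →
            u + w + v + a * ((+ 1 + m) * x) ≡ (+ 0 * a * x + (u + v)) + (a * ((+ 1 + m) * x) + w)
  regroup = solve-∀

Catalan : ℕ → ℤ
Catalan k = + catalan k

Catalan-ratio : (θ Catalan ⊕ Catalan) ∘ suc ≗ + 4 · θ Catalan ⊕ + 2 · Catalan
Catalan-ratio k = begin
  + suc k * Catalan (suc k) + Catalan (suc k)  ≡⟨ collect (+ suc k) (Catalan (suc k)) ⟩
  + suc (suc k) * Catalan (suc k)              ≡⟨ pos-* (suc (suc k)) (catalan (suc k)) ⟨
  + (suc (suc k) ℕ.* catalan (suc k))          ≡⟨ cong +_ (catalan-ratio k) ⟩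
  + (2 ℕ.* (suc (2 ℕ.* k) ℕ.* catalan k))      ≡⟨ pos-* 2 (suc (2 ℕ.* k) ℕ.* catalan k) ⟩
  + 2 * + (suc (2 ℕ.* k) ℕ.* catalan k)        ≡⟨ cong (+ 2 *_) (pos-* (suc (2 ℕ.* k)) (catalan k)) ⟩
  + 2 * (+ suc (2 ℕ.* k) * Catalan k)          ≡⟨ expand (+ k) (Catalan k) ⟩
  + 4 * (+ k * Catalan k) + + 2 * Catalan k    ∎
  where
  open ≡-Reasoning
  collect : ∀ m c → m * c + c ≡ (+ 1 + m) * c
  collect = solve-∀
  expand : ∀ m c → + 2 * ((+ 1 + (m + (m + + 0))) * c) ≡ + 4 * (m * c) + + 2 * c
  expand = solve-∀

θ-∗-self : ∀ f → θ (f ∗ f) ≗ + 2 · (θ f ∗ f)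
θ-∗-self f n = begin
  θ (f ∗ f) n                ≡⟨ θ-∗ f f n ⟩
  (θ f ∗ f) n + (f ∗ θ f) n  ≡⟨ cong (_+_ ((θ f ∗ f) n)) (∗-comm f (θ f) n) ⟩
  (θ f ∗ f) n + (θ f ∗ f) n  ≡⟨ double ((θ f ∗ f) n) ⟩
  + 2 * (θ f ∗ f) n          ∎
  where
  open ≡-Reasoning
  double : ∀ x → x + x ≡ + 2 * x
  double = solve-∀

Catalan-segner : Catalan ∗ Catalan ≗ Catalan ∘ suc
Catalan-segner zero    = refl
Catalan-segner (suc n) = *-cancelˡ-≡ (+ (3 ℕ.+ n)) _ _ (begin
  + (3 ℕ.+ n) * S₁                        ≡⟨ split (+ n) S₁ ⟩
  + suc n * S₁ + + 2 * S₁                 ≡⟨ cong (_+ + 2 * S₁) (θ-∗-self Catalan (suc n)) ⟩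
  + 2 * D₁ + + 2 * S₁                     ≡⟨ *-distribˡ-+ (+ 2) D₁ S₁ ⟨
  + 2 * (D₁ + S₁)                         ≡⟨ cong (+ 2 *_) step ⟩
  + 2 * (C₁ + (+ 4 * D₀ + + 2 * S₀))      ≡⟨ regroup C₁ D₀ S₀ ⟩
  + 2 * C₁ + + 4 * (+ 2 * D₀) + + 4 * S₀
    ≡⟨ cong (λ u → + 2 * C₁ + + 4 * u + + 4 * S₀) (θ-∗-self Catalan n) ⟨
  + 2 * C₁ + + 4 * (+ n * S₀) + + 4 * S₀
    ≡⟨ cong (λ u → + 2 * C₁ + + 4 * (+ n * u) + + 4 * u) (Catalan-segner n) ⟩
  + 2 * C₁ + + 4 * (+ n * C₁) + + 4 * C₁  ≡⟨ collect (+ n) C₁ ⟩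
  + 4 * (+ suc n * C₁) + + 2 * C₁         ≡⟨ Catalan-ratio (suc n) ⟨
  + suc (suc n) * C₂ + C₂                 ≡⟨ split′ (+ n) C₂ ⟩
  + (3 ℕ.+ n) * C₂                        ∎)
  where
  open ≡-Reasoning
  C₁ = Catalan (suc n)
  C₂ = Catalan (suc (suc n))
  S₀ = (Catalan ∗ Catalan) n
  S₁ = (Catalan ∗ Catalan) (suc n)
  D₀ = (θ Catalan ∗ Catalan) n
  D₁ = (θ Catalan ∗ Catalan) (suc n)
  step : D₁ + S₁ ≡ C₁ + (+ 4 * D₀ + + 2 * S₀)
  step = begin
    D₁ + S₁
      ≡⟨ ∗-distribʳ-⊕ (θ Catalan) Catalan Catalan (suc n) ⟨
    + 1 * C₁ + (((θ Catalan ⊕ Catalan) ∘ suc) ∗ Catalan) n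
      ≡⟨ cong₂ _+_ (*-identityˡ C₁) (∗-congˡ Catalan Catalan-ratio n) ⟩
    C₁ + ((+ 4 · θ Catalan ⊕ + 2 · Catalan) ∗ Catalan) n
      ≡⟨ cong (_+_ C₁) (∗-distribʳ-⊕ (+ 4 · θ Catalan) (+ 2 · Catalan) Catalan n) ⟩
    C₁ + ((+ 4 · θ Catalan ∗ Catalan) n + (+ 2 · Catalan ∗ Catalan) n)
      ≡⟨ cong (_+_ C₁) (cong₂ _+_ (·-∗ (+ 4) (θ Catalan) Catalan n) (·-∗ (+ 2) Catalan Catalan n)) ⟩
    C₁ + (+ 4 * D₀ + + 2 * S₀) ∎
  split : ∀ m s → (+ 2 + (+ 1 + m)) * s ≡ (+ 1 + m) * s + + 2 * s
  split = solve-∀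
  regroup : ∀ c d s → + 2 * (c + (+ 4 * d + + 2 * s)) ≡ + 2 * c + + 4 * (+ 2 * d) + + 4 * s
  regroup = solve-∀
  collect : ∀ m c → + 2 * c + + 4 * (m * c) + + 4 * c ≡ + 4 * ((+ 1 + m) * c) + + 2 * c
  collect = solve-∀
  split′ : ∀ m c → (+ 1 + (+ 1 + m)) * c + c ≡ (+ 2 + (+ 1 + m)) * c
  split′ = solve-∀

y : ℕ → ℤ
y = shift (twist Catalan)

y∗y : ∀ j → (y ∗ y) (suc (suc j)) ≡ sign j * Catalan (suc j)
y∗y j = begin
  (y ∗ y) (suc (suc j))              ≡⟨ shift-∗ (twist Catalan) y (suc (suc j)) ⟩
  (twist Catalan ∗ y) (suc j)        ≡⟨ ∗-shift (twist Catalan) (twist Catalan) (suc j) ⟩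
  (twist Catalan ∗ twist Catalan) j  ≡⟨ twist-∗ Catalan Catalan j ⟩
  sign j * (Catalan ∗ Catalan) j     ≡⟨ cong (sign j *_) (Catalan-segner j) ⟩
  sign j * Catalan (suc j)           ∎
  where open ≡-Reasoning

y-quadratic : y ⊕ y ∗ y ≗ X
y-quadratic zero          = refl
y-quadratic (suc zero)    = refl
y-quadratic (suc (suc j)) = begin
  - sign j * Catalan (suc j) + (y ∗ y) (suc (suc j))
    ≡⟨ cong (_+_ (- sign j * Catalan (suc j))) (y∗y j) ⟩
  - sign j * Catalan (suc j) + sign j * Catalan (suc j)
    ≡⟨ cong (_+ sign j * Catalan (suc j)) (neg-distribˡ-* (sign j) _) ⟨
  - (sign j * Catalan (suc j)) + sign j * Catalan (suc j)  ≡⟨ +-inverseˡ (sign j * Catalan (suc j)) ⟩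
  + 0                                                      ∎
  where open ≡-Reasoning

fibPoly : ℕ → ℕ → ℤ
fibPoly ℓ n = + ((ℓ ∸ n) C n)

fibPoly-rec : ∀ ℓ → fibPoly (suc (suc ℓ)) ≗ fibPoly (suc ℓ) ⊕ shift (fibPoly ℓ)
fibPoly-rec ℓ zero    = refl
fibPoly-rec ℓ (suc m) =
  cong +_ (trans (pascal-∸ ℓ m m ℕₚ.≤-refl) (ℕₚ.+-comm ((ℓ ∸ m) C m) _))

fibPoly-∗-y : ∀ ℓ → fibPoly (suc ℓ) ∗ y ≗[< suc (suc ℓ) ] shift (fibPoly ℓ)
fibPoly-∗-y zero    zero          _ = refl
fibPoly-∗-y zero    (suc zero)    _ = refl
fibPoly-∗-y zero    (suc (suc i)) (s≤s (s≤s ()))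
fibPoly-∗-y (suc ℓ) i i<3+ℓ = begin
  (F₂ ∗ y) i                        ≡⟨ ∗-congˡ y (fibPoly-rec ℓ) i ⟩
  ((F₁ ⊕ shift F₀) ∗ y) i           ≡⟨ ∗-distribʳ-⊕ F₁ (shift F₀) y i ⟩
  (F₁ ∗ y) i + (shift F₀ ∗ y) i
    ≡⟨ cong (_+_ ((F₁ ∗ y) i)) (∗-shift-congˡ-< (twist Catalan) (fibPoly-∗-y ℓ) i i<3+ℓ) ⟨
  (F₁ ∗ y) i + ((F₁ ∗ y) ∗ y) i     ≡⟨ cong (_+_ ((F₁ ∗ y) i)) (∗-assoc F₁ y y i) ⟩
  (F₁ ∗ y) i + (F₁ ∗ (y ∗ y)) i     ≡⟨ ∗-distribˡ-⊕ F₁ y (y ∗ y) i ⟨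
  (F₁ ∗ (y ⊕ y ∗ y)) i              ≡⟨ ∗-congʳ F₁ y-quadratic i ⟩
  (F₁ ∗ X) i                        ≡⟨ ∗-X F₁ i ⟩
  shift F₁ i                        ∎
  where
  open ≡-Reasoning
  F₀ = fibPoly ℓ
  F₁ = fibPoly (suc ℓ)
  F₂ = fibPoly (suc (suc ℓ))

sumℤ-++ : ∀ xs ys → sumℤ (xs ++ ys) ≡ sumℤ xs + sumℤ ys
sumℤ-++ []       ys = sym (+-identityˡ (sumℤ ys))
sumℤ-++ (x ∷ xs) ys = trans (cong (_+_ x) (sumℤ-++ xs ys)) (sym (+-assoc x (sumℤ xs) (sumℤ ys)))

sumℤ-concatMap : ∀ {A B : Set} (φ : B → ℤ) (h : A → List B) xs →
                 sumℤ (map φ (concatMap h xs)) ≡ sumℤ (map (λ x → sumℤ (map φ (h x))) xs)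
sumℤ-concatMap φ h []       = refl
sumℤ-concatMap φ h (x ∷ xs) = begin
  sumℤ (map φ (h x ++ concatMap h xs))                ≡⟨ cong sumℤ (map-++ φ (h x) (concatMap h xs)) ⟩
  sumℤ (map φ (h x) ++ map φ (concatMap h xs))        ≡⟨ sumℤ-++ (map φ (h x)) (map φ (concatMap h xs)) ⟩
  sumℤ (map φ (h x)) + sumℤ (map φ (concatMap h xs))
    ≡⟨ cong (_+_ (sumℤ (map φ (h x)))) (sumℤ-concatMap φ h xs) ⟩
  sumℤ (map (λ x → sumℤ (map φ (h x))) (x ∷ xs))      ∎
  where open ≡-Reasoning

sumℤ-*ˡ : ∀ {A : Set} c (φ : A → ℤ) xs → sumℤ (map (λ x → c * φ x) xs) ≡ c * sumℤ (map φ xs)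
sumℤ-*ˡ c φ []       = sym (*-zeroʳ c)
sumℤ-*ˡ c φ (x ∷ xs) =
  trans (cong (_+_ (c * φ x)) (sumℤ-*ˡ c φ xs)) (sym (*-distribˡ-+ c (φ x) (sumℤ (map φ xs))))

map-applyUpTo : ∀ {A B : Set} (g : A → B) f n → map g (applyUpTo f n) ≡ applyUpTo (g ∘ f) n
map-applyUpTo g f zero    = refl
map-applyUpTo g f (suc n) = cong (g (f 0) ∷_) (map-applyUpTo g (f ∘ suc) n)

∗-as-sum : ∀ f g n → (f ∗ g) n ≡ sumℤ (applyUpTo (λ i → f i * g (n ∸ i)) (suc n))
∗-as-sum f g zero    = sym (+-identityʳ (f 0 * g 0))
∗-as-sum f g (suc n) = cong (_+_ (f 0 * g (suc n))) (∗-as-sum (f ∘ suc) g n)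

compositionsAux-fuel : ∀ {k k′ n} → n ≤ k → n ≤ k′ → compositionsAux k n ≡ compositionsAux k′ n
compositionsAux-fuel {n = zero}                    _         _          = refl
compositionsAux-fuel {suc k} {suc k′} {suc n} (s≤s n≤k) (s≤s n≤k′) =
  concatMap-cong (λ m → cong (map (suc m ∷_)) (compositionsAux-fuel (∸-≤ m n≤k) (∸-≤ m n≤k′)))
                 (upTo (suc n))
  where
  ∸-≤ : ∀ m {j} → n ≤ j → n ∸ m ≤ j
  ∸-≤ m = ℕₚ.≤-trans (ℕₚ.m∸n≤m n m)

sumOverCompositions : (List ℕ → ℤ) → ℕ → ℤ
sumOverCompositions φ n = sumℤ (map φ (compositions n))

sumOverCompositions-suc : ∀ {φ ψ : List ℕ → ℤ} c → (∀ m ms → φ (suc m ∷ ms) ≡ c m * ψ ms) →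
                          ∀ n → sumOverCompositions φ (suc n) ≡ (c ∗ sumOverCompositions ψ) n
sumOverCompositions-suc {φ} {ψ} c first-part n = begin
  sumℤ (map φ (concatMap (λ m → map (suc m ∷_) (rest m)) (upTo (suc n))))
    ≡⟨ sumℤ-concatMap φ (λ m → map (suc m ∷_) (rest m)) (upTo (suc n)) ⟩
  sumℤ (map (λ m → sumℤ (map φ (map (suc m ∷_) (rest m)))) (upTo (suc n)))
    ≡⟨ cong sumℤ (map-cong sum-with-first-part (upTo (suc n))) ⟩
  sumℤ (map (λ m → c m * Σψ (n ∸ m)) (upTo (suc n)))
    ≡⟨ cong sumℤ (map-applyUpTo (λ m → c m * Σψ (n ∸ m)) id (suc n)) ⟩
  sumℤ (applyUpTo (λ m → c m * Σψ (n ∸ m)) (suc n))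
    ≡⟨ ∗-as-sum c Σψ n ⟨
  (c ∗ Σψ) n ∎
  where
  open ≡-Reasoning
  Σψ = sumOverCompositions ψ
  rest : ℕ → List (List ℕ)
  rest m = compositionsAux n (n ∸ m)
  sum-with-first-part : ∀ m → sumℤ (map φ (map (suc m ∷_) (rest m))) ≡ c m * Σψ (n ∸ m)
  sum-with-first-part m = begin
    sumℤ (map φ (map (suc m ∷_) (rest m)))       ≡⟨ cong sumℤ (map-∘ (rest m)) ⟨
    sumℤ (map (φ ∘ (suc m ∷_)) (rest m))         ≡⟨ cong sumℤ (map-cong (first-part m) (rest m)) ⟩
    sumℤ (map (λ ms → c m * ψ ms) (rest m))      ≡⟨ sumℤ-*ˡ (c m) ψ (rest m) ⟩
    c m * sumℤ (map ψ (rest m))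
      ≡⟨ cong (λ L → c m * sumℤ (map ψ L)) (compositionsAux-fuel (ℕₚ.m∸n≤m n m) ℕₚ.≤-refl) ⟩
    c m * Σψ (n ∸ m)                             ∎

weight : ℕ → List ℕ → ℤ
weight ℓ ms = sign (length ms) * + tailProd ℓ ms

fibPoly⁻¹ : ℕ → ℕ → ℤ
fibPoly⁻¹ ℓ = sumOverCompositions (weight ℓ)

sign-suc-*-pos : ∀ t b p → sign (suc t) * + (b ℕ.* p) ≡ -1ℤ * + b * (sign t * + p)
sign-suc-*-pos t b p = trans (cong (- sign t *_) (pos-* b p)) (reassociate (sign t) (+ b) (+ p))
  where
  reassociate : ∀ s b p → - s * (b * p) ≡ -1ℤ * b * (s * p)
  reassociate = solve-∀

weight-∷ : ∀ ℓ m ms → weight ℓ (m ∷ ms) ≡ -1ℤ * fibPoly ℓ m * weight ℓ ms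
weight-∷ ℓ m ms = sign-suc-*-pos (length ms) ((ℓ ∸ m) C m) (tailProd ℓ ms)

term-∷ : ∀ n m ms → term (suc n) (suc m ∷ ms) ≡ -1ℤ * fibPoly n m * weight (suc n) ms
term-∷ n m ms = sign-suc-*-pos (length ms) ((n ∸ m) C m) (tailProd (suc n) ms)

fibPoly-∗-fibPoly⁻¹ : ∀ ℓ → fibPoly ℓ ∗ fibPoly⁻¹ ℓ ≗ one
fibPoly-∗-fibPoly⁻¹ ℓ zero    = refl
fibPoly-∗-fibPoly⁻¹ ℓ (suc n) = begin
  + 1 * s (suc n) + ((F ∘ suc) ∗ s) n
    ≡⟨ cong (λ u → + 1 * u + ((F ∘ suc) ∗ s) n) expand-inverse ⟩
  + 1 * (-1ℤ * ((F ∘ suc) ∗ s) n) + ((F ∘ suc) ∗ s) n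
    ≡⟨ cancel (((F ∘ suc) ∗ s) n) ⟩
  + 0 ∎
  where
  open ≡-Reasoning
  F = fibPoly ℓ
  s = fibPoly⁻¹ ℓ
  expand-inverse : s (suc n) ≡ -1ℤ * ((F ∘ suc) ∗ s) n
  expand-inverse = trans (sumOverCompositions-suc (-1ℤ · (F ∘ suc)) (λ m → weight-∷ ℓ (suc m)) n)
                         (·-∗ -1ℤ (F ∘ suc) s n)
  cancel : ∀ x → + 1 * (-1ℤ * x) + x ≡ + 0
  cancel = solve-∀

fibPoly-ratio-coefficient : ∀ n → (fibPoly n ∗ fibPoly⁻¹ (suc n)) n ≡ sign n * Catalan n
fibPoly-ratio-coefficient n = begin
  (F₀ ∗ s) n                    ≡⟨ shift-∗ F₀ s (suc n) ⟨
  (shift F₀ ∗ s) (suc n)        ≡⟨ ∗-congˡ-< s (fibPoly-∗-y n) (suc n) ℕₚ.≤-refl ⟨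
  ((F₁ ∗ y) ∗ s) (suc n)        ≡⟨ ∗-congˡ s (∗-comm F₁ y) (suc n) ⟩
  ((y ∗ F₁) ∗ s) (suc n)        ≡⟨ ∗-assoc y F₁ s (suc n) ⟩
  (y ∗ (F₁ ∗ s)) (suc n)        ≡⟨ ∗-congʳ y (fibPoly-∗-fibPoly⁻¹ (suc n)) (suc n) ⟩
  (y ∗ one) (suc n)             ≡⟨ ∗-identityʳ y (suc n) ⟩
  sign n * Catalan n            ∎
  where
  open ≡-Reasoning
  F₀ = fibPoly n
  F₁ = fibPoly (suc n)
  s = fibPoly⁻¹ (suc n)

lemma3p5 : (ℓ : ℕ) → ℓ ≥ 1 →
    sumℤ (map (term ℓ) (compositions ℓ)) ≡ sign ℓ * (+ catalan (ℓ ∸ 1))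
lemma3p5 (suc n) _ = begin
  sumOverCompositions (term (suc n)) (suc n)
    ≡⟨ sumOverCompositions-suc (-1ℤ · fibPoly n) (term-∷ n) n ⟩
  (-1ℤ · fibPoly n ∗ fibPoly⁻¹ (suc n)) n    ≡⟨ ·-∗ -1ℤ (fibPoly n) (fibPoly⁻¹ (suc n)) n ⟩
  -1ℤ * (fibPoly n ∗ fibPoly⁻¹ (suc n)) n    ≡⟨ cong (-1ℤ *_) (fibPoly-ratio-coefficient n) ⟩
  -1ℤ * (sign n * Catalan n)                 ≡⟨ -1*i≡-i (sign n * Catalan n) ⟩
  - (sign n * Catalan n)                     ≡⟨ neg-distribˡ-* (sign n) (Catalan n) ⟩
  sign (suc n) * + catalan n                 ∎
  where open ≡-Reasoning
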